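{- Let $N = q^k n^2$ be an odd perfect number given in Eulerian form. Define $G = \gcd(\sigma(q^k),\sigma(n^2))$, $H = \gcd(n^2,\sigma(n^2))$ and $I = \gcd(n,\sigma(n^2))$. Then $G \cdot H = I^2$.
   Context: $\sigma(x)$ denotes the sum of the positive divisors of $x$. A positive integer $N$ is perfect if $\sigma(N)=2N$. An odd perfect number $N$ is said to be given in Eulerian form $N = q^k n^2$ if $q$ is a prime (the special prime), $k$ and $n$ are positive integers, $q \equiv k \equiv 1 \pmod 4$, and $\gcd(q,n)=1$. -}

module Defs where

open import Data.Nat using (ℕ; suc; _+_; _*_; _^_; _<_)
open import Data.Nat.Divisibility using (_∣?_)
open import Data.List using (List; upTo; filter; map)
open import Data.Nat.ListAction using (sum)
open import Data.Nat.Primality using (Prime)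
open import Data.Nat.GCD using (gcd)
open import Data.Nat.DivMod using (_%_)
open import Data.Product using (_×_)
open import Relation.Binary.PropositionalEquality using (_≡_)

divisors : ℕ → List ℕ
divisors x = filter (_∣? x) (map suc (upTo x))

σ : ℕ → ℕ
σ x = sum (divisors x)

Perfect : ℕ → Set
Perfect N = σ N ≡ 2 * N

-- positive integer N is perfect iff σ(N) = 2N (positivity imposed in EulerianOPN)
-- N = q^k n^2 is an odd perfect number in Eulerian form
EulerianOPN : ℕ → ℕ → ℕ → ℕ → Set
EulerianOPN N q k n =
  0 < N × 0 < k × 0 < n × Perfect N × N % 2 ≡ 1 × N ≡ q ^ k * n ^ 2 × Prime q ×
  q % 4 ≡ 1 × k % 4 ≡ 1 × gcd q n ≡ 1

-- Since q ∤ n², σ is multiplicative on q^k n², so σ(q^k) σ(n²) = 2 q^k n². As q ≡ k ≡ 1 (mod 4),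
-- σ(q^k) = 1 + q + ⋯ + q^k is even, say σ(q^k) = 2a, and a is coprime to q because σ(q^k) ≡ 1 (mod q).
-- Hence a ∣ n², and writing n² = m a gives σ(n²) = q^k m with σ(n²) odd. Then
-- G = gcd(a, m), H = gcd(m a, m q^k) = m and I = gcd(n, m), so
-- G H = gcd(m a, m²) = gcd(n², m²) = gcd(n, m)² = I².
module Submission where

open import Data.Bool using (if_then_else_)
open import Data.List using ([]; _∷_; upTo; applyUpTo; filter; map)
open import Data.List.Properties using (map-upTo; map-applyUpTo)
open import Data.Nat
open import Data.Nat.Coprimality
  using (Coprime; coprime-divisor; coprime-/gcd; coprime⇒gcd≡1; gcd≡1⇒coprime; 1-coprimeTo)
  renaming (sym to coprime-sym)
open import Data.Nat.DivMod
open import Data.Nat.Divisibility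
open import Data.Nat.GCD
open import Data.Nat.ListAction using (sum)
open import Data.Nat.Primality using (Prime; prime[2]; prime⇒irreducible; prime⇒nonZero; ¬prime[1])
open import Data.Nat.Properties
open import Algebra.Properties.CommutativeSemigroup +-commutativeSemigroup using () renaming (interchange to +-interchange)
open import Algebra.Properties.CommutativeSemigroup *-commutativeSemigroup using ()
  renaming (interchange to *-interchange; x∙yz≈y∙xz to *-left-commute)
open import Data.Product using (_,_)
open import Data.Sum using (inj₁; inj₂)
open import Defs
open import Function using (_∘_; id; _⇔_; mk⇔; Equivalence)
open import Relation.Binary.PropositionalEquality
open import Relation.Nullary using (¬_; yes; no; does; contradiction)
open import Relation.Unary using (Pred; Decidable)
open import Relation.Unary.Properties using (∁?)

prime-∤⇒coprime : ∀ {p d} → Prime p → ¬ p ∣ d → Coprime d p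
prime-∤⇒coprime p-prime p∤d (i∣d , i∣p) with prime⇒irreducible p-prime i∣p
... | inj₁ i≡1  = i≡1
... | inj₂ refl = contradiction i∣d p∤d

∣-coprime : ∀ {d m n} → d ∣ m → Coprime m n → Coprime d n
∣-coprime d∣m m⊥n (i∣d , i∣n) = m⊥n (∣-trans i∣d d∣m , i∣n)

coprime-* : ∀ {m n o} → Coprime m n → Coprime m o → Coprime m (n * o)
coprime-* m⊥n m⊥o (i∣m , i∣n*o) = m⊥o (i∣m , coprime-divisor (∣-coprime i∣m m⊥n) i∣n*o)

coprime-^ : ∀ {m n} → Coprime m n → ∀ k → Coprime m (n ^ k)
coprime-^ {m} m⊥n zero    = coprime-sym (1-coprimeTo m)
coprime-^ {m} m⊥n (suc k) = coprime-* m⊥n (coprime-^ m⊥n k)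

gcd[m,n*o]≡gcd[m,o] : ∀ {m n} o → Coprime m n → gcd m (n * o) ≡ gcd m o
gcd[m,n*o]≡gcd[m,o] {m} {n} o m⊥n = ∣-antisym
  (gcd-greatest (gcd[m,n]∣m m (n * o))
    (coprime-divisor (∣-coprime (gcd[m,n]∣m m (n * o)) m⊥n) (gcd[m,n]∣n m (n * o))))
  (gcd-greatest (gcd[m,n]∣m m o) (∣n⇒∣m*n n (gcd[m,n]∣n m o)))

^-distribʳ-* : ∀ m n k → (m * n) ^ k ≡ m ^ k * n ^ k
^-distribʳ-* m n zero    = refl
^-distribʳ-* m n (suc k) = trans (cong (m * n *_) (^-distribʳ-* m n k)) (*-interchange m n (m ^ k) (n ^ k))

gcd[m^k,n^k]≡gcd[m,n]^k : ∀ m n k → gcd (m ^ k) (n ^ k) ≡ gcd m n ^ k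
gcd[m^k,n^k]≡gcd[m,n]^k zero      n zero    = refl
gcd[m^k,n^k]≡gcd[m,n]^k zero      n (suc k) =
  trans (gcd-identityˡ (n ^ suc k)) (cong (_^ suc k) (sym (gcd-identityˡ n)))
gcd[m^k,n^k]≡gcd[m,n]^k m@(suc _) n k = begin
  gcd (m ^ k) (n ^ k)
    ≡⟨ cong₂ (λ x y → gcd (x ^ k) (y ^ k)) (m*[n/m]≡n g∣m) (m*[n/m]≡n g∣n) ⟨
  gcd ((g * (m / g)) ^ k) ((g * (n / g)) ^ k)
    ≡⟨ cong₂ gcd (^-distribʳ-* g (m / g) k) (^-distribʳ-* g (n / g) k) ⟩
  gcd (g ^ k * (m / g) ^ k) (g ^ k * (n / g) ^ k)
    ≡⟨ c*gcd[m,n]≡gcd[cm,cn] (g ^ k) ((m / g) ^ k) ((n / g) ^ k) ⟨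
  g ^ k * gcd ((m / g) ^ k) ((n / g) ^ k)
    ≡⟨ cong (g ^ k *_) (coprime⇒gcd≡1 quotients-coprime) ⟩
  g ^ k * 1
    ≡⟨ *-identityʳ (g ^ k) ⟩
  g ^ k
    ∎
  where
  open ≡-Reasoning
  g : ℕ
  g = gcd m n
  g∣m : g ∣ m
  g∣m = gcd[m,n]∣m m n
  g∣n : g ∣ n
  g∣n = gcd[m,n]∣n m n
  instance
    g≢0 : NonZero g
    g≢0 = ≢-nonZero (gcd[m,n]≢0 m n (inj₁ λ ()))
  quotients-coprime : Coprime ((m / g) ^ k) ((n / g) ^ k)
  quotients-coprime = coprime-^ (coprime-sym (coprime-^ (coprime-sym (coprime-/gcd m n)) k)) k

%4≡1⇒%2≡1 : ∀ m → m % 4 ≡ 1 → m % 2 ≡ 1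
%4≡1⇒%2≡1 m m≡1 = trans (sym (m∣n⇒o%n%m≡o%m 2 4 m (divides 2 refl))) (cong (_% 2) m≡1)

sumTo : ℕ → (ℕ → ℕ) → ℕ
sumTo n f = sum (applyUpTo (f ∘ suc) n)

sumTo-cong : ∀ n {f g} → f ≗ g → sumTo n f ≡ sumTo n g
sumTo-cong zero    f≗g = refl
sumTo-cong (suc n) f≗g = cong₂ _+_ (f≗g 1) (sumTo-cong n (f≗g ∘ suc))

sumTo-suc : ∀ n f → sumTo (suc n) f ≡ sumTo n f + f (suc n)
sumTo-suc zero    f = +-identityʳ (f 1)
sumTo-suc (suc n) f = trans (cong (f 1 +_) (sumTo-suc n (f ∘ suc))) (sym (+-assoc (f 1) _ _))

sumTo-+ : ∀ n f g → sumTo n (λ i → f i + g i) ≡ sumTo n f + sumTo n g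
sumTo-+ zero    f g = refl
sumTo-+ (suc n) f g = trans (cong (f 1 + g 1 +_) (sumTo-+ n (f ∘ suc) (g ∘ suc)))
  (+-interchange (f 1) (g 1) _ _)

sumTo-* : ∀ n c f → sumTo n (λ i → c * f i) ≡ c * sumTo n f
sumTo-* zero    c f = sym (*-zeroʳ c)
sumTo-* (suc n) c f = trans (cong (c * f 1 +_) (sumTo-* n c (f ∘ suc))) (sym (*-distribˡ-+ c (f 1) _))

sumTo-+-split : ∀ m n f → sumTo (m + n) f ≡ sumTo m f + sumTo n (λ i → f (m + i))
sumTo-+-split zero    n f = refl
sumTo-+-split (suc m) n f = trans (cong (f 1 +_) (sumTo-+-split m n (f ∘ suc))) (sym (+-assoc (f 1) _ _))

sumTo-≡0 : ∀ n f → (∀ {i} → 1 ≤ i → i ≤ n → f i ≡ 0) → sumTo n f ≡ 0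
sumTo-≡0 zero    f vanish = refl
sumTo-≡0 (suc n) f vanish =
  cong₂ _+_ (vanish (s≤s z≤n) (s≤s z≤n))
    (sumTo-≡0 n (f ∘ suc) (λ _ i≤n → vanish (s≤s z≤n) (s≤s i≤n)))

sumTo-extend : ∀ {m n} f → m ≤ n → (∀ {i} → m < i → f i ≡ 0) → sumTo n f ≡ sumTo m f
sumTo-extend {m} f m≤n vanish with m≤n⇒∃[o]m+o≡n m≤n
... | o , refl = begin
  sumTo (m + o) f                          ≡⟨ sumTo-+-split m o f ⟩
  sumTo m f + sumTo o (λ i → f (m + i))
    ≡⟨ cong (sumTo m f +_) (sumTo-≡0 o _ (λ 1≤i _ → vanish (m<m+n m 1≤i))) ⟩
  sumTo m f + 0                            ≡⟨ +-identityʳ _ ⟩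
  sumTo m f                                ∎
  where open ≡-Reasoning

-- Opaque, so that unification works with keepIf P? f i itself rather than with its unfolding.
opaque
  keepIf : ∀ {p} {P : Pred ℕ p} → Decidable P → (ℕ → ℕ) → ℕ → ℕ
  keepIf P? f i = if does (P? i) then f i else 0

module _ {p} {P : Pred ℕ p} (P? : Decidable P) where
  opaque
    unfolding keepIf

    keepIf-accept : ∀ {f i} → P i → keepIf P? f i ≡ f i
    keepIf-accept {i = i} Pi with P? i
    ... | yes _  = refl
    ... | no ¬Pi = contradiction Pi ¬Pi

    keepIf-reject : ∀ {f i} → ¬ P i → keepIf P? f i ≡ 0
    keepIf-reject {i = i} ¬Pi with P? i
    ... | yes Pi = contradiction Pi ¬Pi
    ... | no _   = refl

    keepIf-≡0 : ∀ {f i} → f i ≡ 0 → keepIf P? f i ≡ 0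
    keepIf-≡0 {i = i} fi≡0 with P? i
    ... | yes _ = fi≡0
    ... | no _  = refl

    keepIf-split : ∀ f i → f i ≡ keepIf P? f i + keepIf (∁? P?) f i
    keepIf-split f i with P? i
    ... | yes _ = sym (+-identityʳ (f i))
    ... | no _  = refl

    sum-filter : ∀ xs → sum (filter P? xs) ≡ sum (map (keepIf P? id) xs)
    sum-filter []       = refl
    sum-filter (x ∷ xs) with P? x
    ... | yes _ = cong (x +_) (sum-filter xs)
    ... | no _  = sum-filter xs

keepIf-cong : ∀ {p q} {P : Pred ℕ p} {Q : Pred ℕ q} (P? : Decidable P) (Q? : Decidable Q) {f g i j} →
  P i ⇔ Q j → (P i → f i ≡ g j) → keepIf P? f i ≡ keepIf Q? g j
keepIf-cong P? Q? {i = i} {j} Pi⇔Qj eq with P? i | Q? j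
... | yes Pi | yes Qj = trans (keepIf-accept P? Pi) (trans (eq Pi) (sym (keepIf-accept Q? Qj)))
... | yes Pi | no ¬Qj = contradiction (Equivalence.to Pi⇔Qj Pi) ¬Qj
... | no ¬Pi | yes Qj = contradiction (Equivalence.from Pi⇔Qj Qj) ¬Pi
... | no ¬Pi | no ¬Qj = trans (keepIf-reject P? ¬Pi) (sym (keepIf-reject Q? ¬Qj))

divisorTerm : ℕ → ℕ → ℕ
divisorTerm x = keepIf (_∣? x) id

σ≡sumTo : ∀ x → σ x ≡ sumTo x (divisorTerm x)
σ≡sumTo x = begin
  sum (filter (_∣? x) (map suc (upTo x)))          ≡⟨ sum-filter (_∣? x) (map suc (upTo x)) ⟩
  sum (map (divisorTerm x) (map suc (upTo x)))     ≡⟨ cong (sum ∘ map (divisorTerm x)) (map-upTo suc x) ⟩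
  sum (map (divisorTerm x) (applyUpTo suc x))      ≡⟨ cong sum (map-applyUpTo suc (divisorTerm x) x) ⟩
  sumTo x (divisorTerm x)                          ∎
  where open ≡-Reasoning

sumTo-first-multiple : ∀ c .{{_ : NonZero c}} g → sumTo c (keepIf (c ∣?_) g) ≡ g c
sumTo-first-multiple c@(suc r) g = begin
  sumTo (suc r) F        ≡⟨ sumTo-suc r F ⟩
  sumTo r F + F (suc r)  ≡⟨ cong₂ _+_ (sumTo-≡0 r F below-c) (keepIf-accept (c ∣?_) ∣-refl) ⟩
  g c                    ∎
  where
  open ≡-Reasoning
  F : ℕ → ℕ
  F = keepIf (c ∣?_) g
  below-c : ∀ {i} → 1 ≤ i → i ≤ r → F i ≡ 0
  below-c {suc _} _ i≤r = keepIf-reject (c ∣?_) (λ c∣i → 1+n≰n (≤-trans (∣⇒≤ c∣i) i≤r))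

sumTo-multiples : ∀ c .{{_ : NonZero c}} n g → sumTo (c * n) (keepIf (c ∣?_) g) ≡ sumTo n (g ∘ (c *_))
sumTo-multiples c zero    g = cong (λ m → sumTo m (keepIf (c ∣?_) g)) (*-zeroʳ c)
sumTo-multiples c (suc n) g = begin
  sumTo (c * suc n) F
    ≡⟨ cong (λ m → sumTo m F) (*-suc c n) ⟩
  sumTo (c + c * n) F
    ≡⟨ sumTo-+-split c (c * n) F ⟩
  sumTo c F + sumTo (c * n) (λ i → F (c + i))
    ≡⟨ cong₂ _+_ (sumTo-first-multiple c g) (sumTo-cong (c * n) shift) ⟩
  g c + sumTo (c * n) (keepIf (c ∣?_) (g ∘ (c +_)))
    ≡⟨ cong (g c +_) (sumTo-multiples c n (g ∘ (c +_))) ⟩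
  g c + sumTo n (λ e → g (c + c * e))
    ≡⟨ cong₂ _+_ (cong g (sym (*-identityʳ c))) (sumTo-cong n (λ e → cong g (sym (*-suc c e)))) ⟩
  sumTo (suc n) (g ∘ (c *_))
    ∎
  where
  open ≡-Reasoning
  F : ℕ → ℕ
  F = keepIf (c ∣?_) g
  shift : ∀ i → F (c + i) ≡ keepIf (c ∣?_) (g ∘ (c +_)) i
  shift i = keepIf-cong (c ∣?_) (c ∣?_)
    (mk⇔ (λ c∣c+i → ∣m+n∣m⇒∣n c∣c+i ∣-refl) (∣m∣n⇒∣m+n ∣-refl)) (λ _ → refl)

divisorTerm-* : ∀ c .{{_ : NonZero c}} x e → divisorTerm (c * x) (c * e) ≡ c * divisorTerm x e
divisorTerm-* c x e with e ∣? x
... | yes e∣x = trans (keepIf-accept (_∣? (c * x)) (*-monoʳ-∣ c e∣x))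
  (cong (c *_) (sym (keepIf-accept (_∣? x) e∣x)))
... | no e∤x  = trans (keepIf-reject (_∣? (c * x)) (e∤x ∘ *-cancelˡ-∣ c))
  (sym (trans (cong (c *_) (keepIf-reject (_∣? x) e∤x)) (*-zeroʳ c)))

σ∣ : ℕ → ℕ → ℕ
σ∣ c x = sumTo x (keepIf (c ∣?_) (divisorTerm x))

σ∤ : ℕ → ℕ → ℕ
σ∤ c x = sumTo x (keepIf (∁? (c ∣?_)) (divisorTerm x))

σ≡σ∣+σ∤ : ∀ c x → σ x ≡ σ∣ c x + σ∤ c x
σ≡σ∣+σ∤ c x = trans (σ≡sumTo x) (trans (sumTo-cong x (keepIf-split (c ∣?_) (divisorTerm x)))
  (sumTo-+ x (keepIf (c ∣?_) (divisorTerm x)) (keepIf (∁? (c ∣?_)) (divisorTerm x))))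

σ∣-* : ∀ c .{{_ : NonZero c}} x → σ∣ c (c * x) ≡ c * σ x
σ∣-* c x = begin
  σ∣ c (c * x)                         ≡⟨ sumTo-multiples c x (divisorTerm (c * x)) ⟩
  sumTo x (λ e → divisorTerm (c * x) (c * e))  ≡⟨ sumTo-cong x (divisorTerm-* c x) ⟩
  sumTo x (λ e → c * divisorTerm x e)  ≡⟨ sumTo-* x c (divisorTerm x) ⟩
  c * sumTo x (divisorTerm x)          ≡⟨ cong (c *_) (sym (σ≡sumTo x)) ⟩
  c * σ x                              ∎
  where open ≡-Reasoning

σ∤≡σ : ∀ {c x} → ¬ c ∣ x → σ∤ c x ≡ σ x
σ∤≡σ {c} {x} c∤x = trans (sumTo-cong x only-non-multiples) (sym (σ≡sumTo x))
  where
  only-non-multiples : ∀ d → keepIf (∁? (c ∣?_)) (divisorTerm x) d ≡ divisorTerm x d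
  only-non-multiples d with c ∣? d
  ... | yes c∣d =
    trans (keepIf-reject (∁? (c ∣?_)) (λ c∤d → c∤d c∣d))
      (sym (keepIf-reject (_∣? x) (c∤x ∘ ∣-trans c∣d)))
  ... | no c∤d  = keepIf-accept (∁? (c ∣?_)) c∤d

module _ {p} (p-prime : Prime p) where

  private instance
    p≢0 : NonZero p
    p≢0 = prime⇒nonZero p-prime

  σ∤-* : ∀ x → σ∤ p (p * x) ≡ σ∤ p x
  σ∤-* zero       = cong (σ∤ p) (*-zeroʳ p)
  σ∤-* x@(suc _) = trans (sumTo-cong (p * x) same-terms) (sumTo-extend _ (m≤n*m x p) beyond-x)
    where
    same-terms : ∀ d → keepIf (∁? (p ∣?_)) (divisorTerm (p * x)) d ≡ keepIf (∁? (p ∣?_)) (divisorTerm x) d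
    same-terms d = keepIf-cong (∁? (p ∣?_)) (∁? (p ∣?_)) (mk⇔ id id) λ p∤d →
      keepIf-cong (_∣? (p * x)) (_∣? x)
        (mk⇔ (coprime-divisor (prime-∤⇒coprime p-prime p∤d)) (∣n⇒∣m*n p)) (λ _ → refl)
    beyond-x : ∀ {d} → x < d → keepIf (∁? (p ∣?_)) (divisorTerm x) d ≡ 0
    beyond-x x<d = keepIf-≡0 (∁? (p ∣?_)) (keepIf-reject (_∣? x) (λ d∣x → <⇒≱ x<d (∣⇒≤ d∣x)))

  σ∤-^* : ∀ {m} → ¬ p ∣ m → ∀ k → σ∤ p (p ^ k * m) ≡ σ m
  σ∤-^* {m} p∤m zero    = trans (cong (σ∤ p) (*-identityˡ m)) (σ∤≡σ p∤m)
  σ∤-^* {m} p∤m (suc k) = trans (cong (σ∤ p) (*-assoc p (p ^ k) m)) (trans (σ∤-* (p ^ k * m)) (σ∤-^* p∤m k))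

  σ-^-suc-* : ∀ {m} → ¬ p ∣ m → ∀ k → σ (p ^ suc k * m) ≡ σ m + p * σ (p ^ k * m)
  σ-^-suc-* {m} p∤m k = begin
    σ (p ^ suc k * m)                  ≡⟨ cong σ (*-assoc p (p ^ k) m) ⟩
    σ (p * (p ^ k * m))                ≡⟨ σ≡σ∣+σ∤ p (p * (p ^ k * m)) ⟩
    σ∣ p (p * (p ^ k * m)) + σ∤ p (p * (p ^ k * m))
      ≡⟨ cong₂ _+_ (σ∣-* p (p ^ k * m)) (trans (σ∤-* (p ^ k * m)) (σ∤-^* p∤m k)) ⟩
    p * σ (p ^ k * m) + σ m            ≡⟨ +-comm _ (σ m) ⟩
    σ m + p * σ (p ^ k * m)            ∎
    where open ≡-Reasoning

  p∤1 : ¬ p ∣ 1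
  p∤1 p∣1 = ¬prime[1] (subst Prime (∣1⇒≡1 p∣1) p-prime)

  σ-^-suc : ∀ k → σ (p ^ suc k) ≡ 1 + p * σ (p ^ k)
  σ-^-suc k = begin
    σ (p ^ suc k)              ≡⟨ cong σ (sym (*-identityʳ (p ^ suc k))) ⟩
    σ (p ^ suc k * 1)          ≡⟨ σ-^-suc-* p∤1 k ⟩
    1 + p * σ (p ^ k * 1)      ≡⟨ cong (λ x → 1 + p * σ x) (*-identityʳ (p ^ k)) ⟩
    1 + p * σ (p ^ k)          ∎
    where open ≡-Reasoning

  σ-^-* : ∀ {m} → ¬ p ∣ m → ∀ k → σ (p ^ k * m) ≡ σ (p ^ k) * σ m
  σ-^-* {m} p∤m zero    = trans (cong σ (*-identityˡ m)) (sym (*-identityˡ (σ m)))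
  σ-^-* {m} p∤m (suc k) = begin
    σ (p ^ suc k * m)                ≡⟨ σ-^-suc-* p∤m k ⟩
    σ m + p * σ (p ^ k * m)          ≡⟨ cong (λ x → σ m + p * x) (σ-^-* p∤m k) ⟩
    σ m + p * (σ (p ^ k) * σ m)      ≡⟨ cong₂ _+_ (*-identityˡ (σ m)) (*-assoc p (σ (p ^ k)) (σ m)) ⟨
    1 * σ m + p * σ (p ^ k) * σ m    ≡⟨ *-distribʳ-+ (σ m) 1 (p * σ (p ^ k)) ⟨
    (1 + p * σ (p ^ k)) * σ m        ≡⟨ cong (_* σ m) (σ-^-suc k) ⟨
    σ (p ^ suc k) * σ m              ∎
    where open ≡-Reasoning

  σ-^-% : ∀ {d} .{{_ : NonZero d}} → p % d ≡ 1 % d → ∀ k → σ (p ^ k) % d ≡ suc k % d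
  σ-^-% {d} p≡1 zero    = refl
  σ-^-% {d} p≡1 (suc k) = begin
    σ (p ^ suc k) % d                  ≡⟨ cong (_% d) (σ-^-suc k) ⟩
    (1 + p * σ (p ^ k)) % d            ≡⟨ %-distribˡ-+ 1 (p * σ (p ^ k)) d ⟩
    (1 % d + p * σ (p ^ k) % d) % d    ≡⟨ cong (λ x → (1 % d + x) % d) p*σ≡suc-k ⟩
    (1 % d + suc k % d) % d            ≡⟨ %-distribˡ-+ 1 (suc k) d ⟨
    suc (suc k) % d                    ∎
    where
    open ≡-Reasoning
    p*σ≡suc-k : p * σ (p ^ k) % d ≡ suc k % d
    p*σ≡suc-k = begin
      p * σ (p ^ k) % d                ≡⟨ %-distribˡ-* p (σ (p ^ k)) d ⟩
      (p % d) * (σ (p ^ k) % d) % d    ≡⟨ cong₂ (λ x y → x * y % d) p≡1 (σ-^-% p≡1 k) ⟩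
      (1 % d) * (suc k % d) % d        ≡⟨ %-distribˡ-* 1 (suc k) d ⟨
      1 * suc k % d                    ≡⟨ cong (_% d) (*-identityˡ (suc k)) ⟩
      suc k % d                        ∎

  σ-^-even : p % 4 ≡ 1 → ∀ k → k % 4 ≡ 1 → 2 ∣ σ (p ^ k)
  σ-^-even p≡1 k k≡1 = m%n≡0⇒n∣m (σ (p ^ k)) 2 (begin
    σ (p ^ k) % 2        ≡⟨ σ-^-% (%4≡1⇒%2≡1 p p≡1) k ⟩
    suc k % 2            ≡⟨ %-distribˡ-+ 1 k 2 ⟩
    (1 + k % 2) % 2      ≡⟨ cong (λ r → (1 + r) % 2) (%4≡1⇒%2≡1 k k≡1) ⟩
    0                    ∎)
    where open ≡-Reasoning

  σ-^-coprime : ∀ k → Coprime (σ (p ^ k)) p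
  σ-^-coprime zero                = 1-coprimeTo p
  σ-^-coprime (suc k) (i∣σ , i∣p) =
    ∣1⇒≡1 (∣m+n∣m⇒∣n (subst (_ ∣_) (trans (σ-^-suc k) (+-comm 1 _)) i∣σ)
                     (∣m⇒∣m*n (σ (p ^ k)) i∣p))

gcd[2a,Qm]*gcd[n²,Qm]≡gcd[n,Qm]² : ∀ {a m n Q} →
  ¬ 2 ∣ Q * m → Coprime a Q → Coprime n Q → n ^ 2 ≡ m * a →
  gcd (2 * a) (Q * m) * gcd (n ^ 2) (Q * m) ≡ gcd n (Q * m) ^ 2
gcd[2a,Qm]*gcd[n²,Qm]≡gcd[n,Qm]² {a} {m} {n} {Q} Qm-odd a⊥Q n⊥Q n²≡ma = begin
  gcd (2 * a) (Q * m) * gcd (n ^ 2) (Q * m)  ≡⟨ cong₂ _*_ G≡gcd[a,m] H≡m ⟩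
  gcd a m * m                                ≡⟨ *-comm (gcd a m) m ⟩
  m * gcd a m                                ≡⟨ c*gcd[m,n]≡gcd[cm,cn] m a m ⟩
  gcd (m * a) (m * m)                        ≡⟨ cong₂ gcd n²≡ma (cong (m *_) (*-identityʳ m)) ⟨
  gcd (n ^ 2) (m ^ 2)                        ≡⟨ gcd[m^k,n^k]≡gcd[m,n]^k n m 2 ⟩
  gcd n m ^ 2                                ≡⟨ cong (_^ 2) (gcd[m,n*o]≡gcd[m,o] m n⊥Q) ⟨
  gcd n (Q * m) ^ 2                          ∎
  where
  open ≡-Reasoning
  G≡gcd[a,m] : gcd (2 * a) (Q * m) ≡ gcd a m
  G≡gcd[a,m] = begin
    gcd (2 * a) (Q * m)  ≡⟨ gcd-comm (2 * a) (Q * m) ⟩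
    gcd (Q * m) (2 * a)  ≡⟨ gcd[m,n*o]≡gcd[m,o] a (prime-∤⇒coprime prime[2] Qm-odd) ⟩
    gcd (Q * m) a        ≡⟨ gcd-comm (Q * m) a ⟩
    gcd a (Q * m)        ≡⟨ gcd[m,n*o]≡gcd[m,o] m a⊥Q ⟩
    gcd a m              ∎
  H≡m : gcd (n ^ 2) (Q * m) ≡ m
  H≡m = begin
    gcd (n ^ 2) (Q * m)  ≡⟨ cong₂ gcd n²≡ma (*-comm Q m) ⟩
    gcd (m * a) (m * Q)  ≡⟨ c*gcd[m,n]≡gcd[cm,cn] m a Q ⟨
    m * gcd a Q          ≡⟨ cong (m *_) (coprime⇒gcd≡1 a⊥Q) ⟩
    m * 1                ≡⟨ *-identityʳ m ⟩
    m                    ∎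

gcd[A,B]*gcd[n²,B]≡gcd[n,B]² : ∀ {A B Q n} → A * B ≡ 2 * (Q * n ^ 2) → ¬ 2 ∣ Q * n ^ 2 → 2 ∣ A →
  Coprime A Q → Coprime n Q → gcd A B * gcd (n ^ 2) B ≡ gcd n B ^ 2
gcd[A,B]*gcd[n²,B]≡gcd[n,B]² {A} {B} {Q} {n} AB≡2Qn² Qn²-odd 2∣A A⊥Q n⊥Q = begin
  gcd A B * gcd (n ^ 2) B              ≡⟨ cong₂ (λ x y → gcd x y * gcd (n ^ 2) y) A≡2a B≡Qm ⟩
  gcd (2 * a) (Q * m) * gcd (n ^ 2) (Q * m)
    ≡⟨ gcd[2a,Qm]*gcd[n²,Qm]≡gcd[n,Qm]² Qm-odd a⊥Q n⊥Q n²≡ma ⟩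
  gcd n (Q * m) ^ 2                    ≡⟨ cong (λ y → gcd n y ^ 2) B≡Qm ⟨
  gcd n B ^ 2                          ∎
  where
  open ≡-Reasoning
  a : ℕ
  a = quotient 2∣A
  A≡2a : A ≡ 2 * a
  A≡2a = m∣n⇒n≡m*quotient 2∣A
  aB≡Qn² : a * B ≡ Q * n ^ 2
  aB≡Qn² = *-cancelˡ-≡ (a * B) (Q * n ^ 2) 2
    (trans (sym (*-assoc 2 a B)) (trans (cong (_* B) (sym A≡2a)) AB≡2Qn²))
  a⊥Q : Coprime a Q
  a⊥Q = ∣-coprime (quotient-∣ 2∣A) A⊥Q
  a∣n² : a ∣ n ^ 2
  a∣n² = coprime-divisor a⊥Q (divides B (trans (sym aB≡Qn²) (*-comm a B)))
  m : ℕ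
  m = quotient a∣n²
  n²≡ma : n ^ 2 ≡ m * a
  n²≡ma = m∣n⇒n≡quotient*m a∣n²
  instance
    a≢0 : NonZero a
    a≢0 = ≢-nonZero λ a≡0 → Qn²-odd (subst (2 ∣_) (trans (cong (_* B) (sym a≡0)) aB≡Qn²) (2 ∣0))
  B≡Qm : B ≡ Q * m
  B≡Qm = *-cancelˡ-≡ B (Q * m) a
    (trans aB≡Qn² (trans (cong (Q *_) (trans n²≡ma (*-comm m a))) (*-left-commute Q a m)))
  Qm-odd : ¬ 2 ∣ Q * m
  Qm-odd 2∣Qm = Qn²-odd (subst (2 ∣_) (trans (cong (a *_) (sym B≡Qm)) aB≡Qn²) (∣n⇒∣m*n a 2∣Qm))

lemma1 : (N q k n : ℕ) → EulerianOPN N q k n →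
    gcd (σ (q ^ k)) (σ (n ^ 2)) * gcd (n ^ 2) (σ (n ^ 2)) ≡ gcd n (σ (n ^ 2)) ^ 2
lemma1 N q k n (_ , _ , _ , perfect , N-odd , N≡q^kn² , q-prime , q≡1 , k≡1 , gcd[q,n]≡1) =
  gcd[A,B]*gcd[n²,B]≡gcd[n,B]² σ[q^k]σ[n²]≡2N q^kn²-odd (σ-^-even q-prime q≡1 k k≡1)
    (coprime-^ (σ-^-coprime q-prime k) k) (coprime-^ (coprime-sym q⊥n) k)
  where
  open ≡-Reasoning
  q⊥n : Coprime q n
  q⊥n = gcd≡1⇒coprime gcd[q,n]≡1
  q∤n² : ¬ q ∣ n ^ 2
  q∤n² q∣n² = ¬prime[1] (subst Prime (coprime-^ q⊥n 2 (∣-refl , q∣n²)) q-prime)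
  σ[q^k]σ[n²]≡2N : σ (q ^ k) * σ (n ^ 2) ≡ 2 * (q ^ k * n ^ 2)
  σ[q^k]σ[n²]≡2N = begin
    σ (q ^ k) * σ (n ^ 2)  ≡⟨ σ-^-* q-prime q∤n² k ⟨
    σ (q ^ k * n ^ 2)      ≡⟨ cong σ N≡q^kn² ⟨
    σ N                    ≡⟨ perfect ⟩
    2 * N                  ≡⟨ cong (2 *_) N≡q^kn² ⟩
    2 * (q ^ k * n ^ 2)    ∎
  q^kn²-odd : ¬ 2 ∣ q ^ k * n ^ 2
  q^kn²-odd 2∣N = 0≢1+n (trans (sym (n∣m⇒m%n≡0 N 2 (subst (2 ∣_) (sym N≡q^kn²) 2∣N))) N-odd)
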